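{- For all $A,B\in\mathcal I$ we have $A\leq_{\mathcal I}B$ if and only if $F(A)\subseteq F(B)$; i.e. $F$ is an embedding of $(\mathcal I,\leq_{\mathcal I})$ into $(\mathcal C,\subseteq)$.
   Context: $\mathcal I$ is the set of all finite sets of pairwise disjoint closed intervals $[a,b]$ with $a,b\in\mathbb Q$, $0\le a<b\le 1$; $A\leq_{\mathcal I}B$ iff every interval of $A$ is contained in some interval of $B$. $\mathcal C$ is the set of convex hulls of finite subsets of $\mathbb Q^2$ (the hull of the empty set being empty), ordered by inclusion. For $A\in\mathcal I$, $F(A)\in\mathcal C$ is the convex hull of the points $(a,a^2)$, $\big(\tfrac{a+b}{2},ab\big)$, $(b,b^2)$ for all $[a,b]\in A$. -}

module Defs where

open import Data.Rational using (ℚ; 0ℚ; 1ℚ; ½; _+_; _*_; _≤_; _<_)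
open import Data.Product using (Σ; _×_; _,_; proj₁; proj₂)
open import Data.Sum using (_⊎_)
open import Data.List using (List; []; _∷_; length; foldr; zipWith; concatMap)
open import Data.List.Relation.Unary.All using (All)
open import Data.List.Relation.Unary.Any using (Any)
open import Data.List.Relation.Unary.AllPairs using (AllPairs)
open import Relation.Binary.PropositionalEquality using (_≡_)

record Interval : Set where
  constructor [_,_]⟨_,_,_⟩
  field
    lo hi : ℚ
    0≤lo : 0ℚ ≤ lo
    lo<hi : lo < hi
    hi≤1 : hi ≤ 1ℚ
open Interval public

Disjoint : Interval → Interval → Set
Disjoint I J = (hi I < lo J) ⊎ (hi J < lo I)

record 𝓘 : Set where
  constructor mk𝓘
  field
    intervals : List Interval
    pairwiseDisjoint : AllPairs Disjoint intervals
open 𝓘 public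

_⊆ᵢ_ : Interval → Interval → Set
I ⊆ᵢ J = (lo J ≤ lo I) × (hi I ≤ hi J)

_≤𝓘_ : 𝓘 → 𝓘 → Set
A ≤𝓘 B = All (λ I → Any (λ J → I ⊆ᵢ J) (intervals B)) (intervals A)

Point : Set
Point = ℚ × ℚ

sumℚ : List ℚ → ℚ
sumℚ = foldr _+_ 0ℚ

InHull : List Point → Point → Set
InHull ps p = Σ (List ℚ) λ ws →
    (length ws ≡ length ps)
  × All (0ℚ ≤_) ws
  × (sumℚ ws ≡ 1ℚ)
  × (sumℚ (zipWith (λ w q → w * proj₁ q) ws ps) ≡ proj₁ p)
  × (sumℚ (zipWith (λ w q → w * proj₂ q) ws ps) ≡ proj₂ p)

Hull : List Point → Point → Set
Hull = InHull

intervalPoints : Interval → List Point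
intervalPoints I = (lo I , lo I * lo I) ∷ ((lo I + hi I) * ½ , lo I * hi I) ∷ (hi I , hi I * hi I) ∷ []

F : 𝓘 → Point → Set
F A = Hull (concatMap intervalPoints (intervals A))

_⊆ℚ²_ : (Point → Set) → (Point → Set) → Set
X ⊆ℚ² Y = ∀ p → X p → Y p

-- Every generator of F(A) is a value of the polar form (c,d) ↦ ((c+d)/2, cd) of
-- x ↦ x² on some interval of A, and on an interval [a,b] the polar form at any
-- c, d ∈ [a,b] is a convex combination of its values at (a,a), (a,b), (b,b)
-- (with Bernstein weights); hence A ≤ B gives F(A) ⊆ F(B).  Conversely, the
-- tangent to the parabola at x is an affine function vanishing at (x,x²) and
-- positive at the three generators of every interval not containing x, so
-- (x,x²) ∈ F(B) forces x to lie in an interval of B.  Thus F(A) ⊆ F(B) makes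
-- the intervals of B cover each interval I of A, and as they are pairwise
-- disjoint and closed, a single one of them contains I.
module Submission where

open import Defs
open import Algebra.Bundles using (CommutativeMonoid)
open import Data.List using (List; []; _∷_; length; zipWith; concatMap; map; replicate)
open import Data.List.Membership.Propositional using (_∈_; find; lose)
open import Data.List.Membership.Propositional.Properties using (∈-concatMap⁺)
open import Data.List.Properties using (length-map; length-replicate)
open import Data.List.Relation.Binary.Subset.Propositional using (_⊆_)
open import Data.List.Relation.Unary.All as All using (All; []; _∷_)
open import Data.List.Relation.Unary.All.Properties using (concat⁺; map⁺; replicate⁺; ¬Any⇒All¬)
open import Data.List.Relation.Unary.AllPairs using (AllPairs; []; _∷_)
open import Data.List.Relation.Unary.Any using (Any; here; there; any?)
open import Data.Nat using (zero; suc)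
open import Data.Nat.Properties using (suc-injective)
open import Data.Product using (Σ; ∃; _×_; _,_; proj₁; proj₂; <_,_>)
open import Data.Rational using (ℚ; 0ℚ; 1ℚ; ½; _+_; _*_; _-_; -_; _⊓_; _≤_; _<_; _≤?_; _<?_; 1/_;
  Positive; NonZero; positive; negative; nonNegative)
open import Data.Rational.Properties
open import Data.Rational.Solver using (module +-*-Solver)
open import Data.Sum as Sum using (_⊎_; inj₁; inj₂)
open import Relation.Binary.Core using (Rel)
open import Relation.Binary.Definitions using (tri<; tri≈; tri>)
open import Relation.Binary.PropositionalEquality
open import Relation.Nullary using (¬_; Dec; yes; no; contradiction)
open import Relation.Nullary.Decidable using (_×-dec_)
open import Algebra.Properties.CommutativeSemigroup
  (CommutativeMonoid.commutativeSemigroup +-0-commutativeMonoid) using (interchange)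
open +-*-Solver

0≤+ : ∀ {p q} → 0ℚ ≤ p → 0ℚ ≤ q → 0ℚ ≤ p + q
0≤+ {p} {q} 0≤p 0≤q = subst (_≤ p + q) (+-identityʳ 0ℚ) (+-mono-≤ 0≤p 0≤q)

0≤* : ∀ {p q} → 0ℚ ≤ p → 0ℚ ≤ q → 0ℚ ≤ p * q
0≤* {p} {q} 0≤p 0≤q =
  nonNegative⁻¹ (p * q) {{nonNeg*nonNeg⇒nonNeg p {{nonNegative 0≤p}} q {{nonNegative 0≤q}}}}

0<* : ∀ {p q} → (0ℚ < p × 0ℚ < q) ⊎ (p < 0ℚ × q < 0ℚ) → 0ℚ < p * q
0<* {p} {q} (inj₁ (0<p , 0<q)) = positive⁻¹ (p * q) {{pos*pos⇒pos p {{positive 0<p}} q {{positive 0<q}}}}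
0<* {p} {q} (inj₂ (p<0 , q<0)) = positive⁻¹ (p * q) {{neg*neg⇒pos p {{negative p<0}} q {{negative q<0}}}}

p≤q⇒0≤q-p : ∀ {p q} → p ≤ q → 0ℚ ≤ q - p
p≤q⇒0≤q-p {p} {q} p≤q = subst (_≤ q - p) (+-inverseʳ p) (+-monoˡ-≤ (- p) p≤q)

p<q⇒0<q-p : ∀ {p q} → p < q → 0ℚ < q - p
p<q⇒0<q-p {p} {q} p<q = subst (_< q - p) (+-inverseʳ p) (+-monoˡ-< (- p) p<q)

p<q⇒p-q<0 : ∀ {p q} → p < q → p - q < 0ℚ
p<q⇒p-q<0 {p} {q} p<q = subst (p - q <_) (+-inverseʳ q) (+-monoˡ-< (- q) p<q)

<-⊓ : ∀ {r p q} → r < p → r < q → r < p ⊓ q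
<-⊓ {r} {p} {q} r<p r<q with ⊓-sel p q
... | inj₁ p⊓q≡p = subst (r <_) (sym p⊓q≡p) r<p
... | inj₂ p⊓q≡q = subst (r <_) (sym p⊓q≡q) r<q

weightedSum : (Point → ℚ) → List ℚ → List Point → ℚ
weightedSum f ws ps = sumℚ (zipWith (λ w q → w * f q) ws ps)

Combination : List Point → ℚ → Point → Set
Combination ps s p = Σ (List ℚ) λ ws →
    (length ws ≡ length ps)
  × All (0ℚ ≤_) ws
  × (sumℚ ws ≡ s)
  × (weightedSum proj₁ ws ps ≡ proj₁ p)
  × (weightedSum proj₂ ws ps ≡ proj₂ p)

length-zipWith-+ : ∀ (xs ys : List ℚ) → length xs ≡ length ys → length (zipWith _+_ xs ys) ≡ length xs
length-zipWith-+ []       []       _  = refl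
length-zipWith-+ (x ∷ xs) (y ∷ ys) eq = cong suc (length-zipWith-+ xs ys (suc-injective eq))

sumℚ-replicate-0 : ∀ n → sumℚ (replicate n 0ℚ) ≡ 0ℚ
sumℚ-replicate-0 zero    = refl
sumℚ-replicate-0 (suc n) = trans (+-identityˡ _) (sumℚ-replicate-0 n)

weightedSum-replicate-0 : ∀ f n ps → weightedSum f (replicate n 0ℚ) ps ≡ 0ℚ
weightedSum-replicate-0 f zero    ps       = refl
weightedSum-replicate-0 f (suc n) []       = refl
weightedSum-replicate-0 f (suc n) (q ∷ ps) =
  trans (cong₂ _+_ (*-zeroˡ (f q)) (weightedSum-replicate-0 f n ps)) (+-identityˡ 0ℚ)

sumℚ-zipWith-+ : ∀ xs ys → length xs ≡ length ys → sumℚ (zipWith _+_ xs ys) ≡ sumℚ xs + sumℚ ys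
sumℚ-zipWith-+ []       []       _  = sym (+-identityʳ 0ℚ)
sumℚ-zipWith-+ (x ∷ xs) (y ∷ ys) eq =
  trans (cong ((x + y) +_) (sumℚ-zipWith-+ xs ys (suc-injective eq))) (interchange x y _ _)

weightedSum-zipWith-+ : ∀ f xs ys ps → length xs ≡ length ys →
  weightedSum f (zipWith _+_ xs ys) ps ≡ weightedSum f xs ps + weightedSum f ys ps
weightedSum-zipWith-+ f []       []       ps       _  = sym (+-identityʳ 0ℚ)
weightedSum-zipWith-+ f (x ∷ xs) (y ∷ ys) []       _  = sym (+-identityʳ 0ℚ)
weightedSum-zipWith-+ f (x ∷ xs) (y ∷ ys) (q ∷ ps) eq =
  trans (cong₂ _+_ (*-distribʳ-+ (f q) x y) (weightedSum-zipWith-+ f xs ys ps (suc-injective eq)))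
        (interchange (x * f q) (y * f q) _ _)

sumℚ-map-* : ∀ w xs → sumℚ (map (w *_) xs) ≡ w * sumℚ xs
sumℚ-map-* w []       = sym (*-zeroʳ w)
sumℚ-map-* w (x ∷ xs) = trans (cong (w * x +_) (sumℚ-map-* w xs)) (sym (*-distribˡ-+ w x _))

weightedSum-map-* : ∀ f w xs ps → weightedSum f (map (w *_) xs) ps ≡ w * weightedSum f xs ps
weightedSum-map-* f w []       ps       = sym (*-zeroʳ w)
weightedSum-map-* f w (x ∷ xs) []       = sym (*-zeroʳ w)
weightedSum-map-* f w (x ∷ xs) (q ∷ ps) =
  trans (cong₂ _+_ (*-assoc w x (f q)) (weightedSum-map-* f w xs ps)) (sym (*-distribˡ-+ w _ _))

All-zipWith-+ : ∀ {xs ys} → All (0ℚ ≤_) xs → All (0ℚ ≤_) ys → All (0ℚ ≤_) (zipWith _+_ xs ys)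
All-zipWith-+ []           _            = []
All-zipWith-+ (_ ∷ _)      []           = []
All-zipWith-+ (0≤x ∷ 0≤xs) (0≤y ∷ 0≤ys) = 0≤+ 0≤x 0≤y ∷ All-zipWith-+ 0≤xs 0≤ys

combination-zero : ∀ Q → Combination Q 0ℚ (0ℚ , 0ℚ)
combination-zero Q =
  replicate n 0ℚ , length-replicate n , replicate⁺ n ≤-refl , sumℚ-replicate-0 n ,
  weightedSum-replicate-0 proj₁ n Q , weightedSum-replicate-0 proj₂ n Q
  where n = length Q

combination-+ : ∀ {Q s t p p′} → Combination Q s p → Combination Q t p′ →
  Combination Q (s + t) (proj₁ p + proj₁ p′ , proj₂ p + proj₂ p′)
combination-+ {Q} (us , lu , nu , su , xu , yu) (vs , lv , nv , sv , xv , yv) =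
  zipWith _+_ us vs , trans (length-zipWith-+ us vs l) lu , All-zipWith-+ nu nv ,
  trans (sumℚ-zipWith-+ us vs l) (cong₂ _+_ su sv) ,
  trans (weightedSum-zipWith-+ proj₁ us vs Q l) (cong₂ _+_ xu xv) ,
  trans (weightedSum-zipWith-+ proj₂ us vs Q l) (cong₂ _+_ yu yv)
  where l = trans lu (sym lv)

combination-* : ∀ {Q s w p} → 0ℚ ≤ w → Combination Q s p → Combination Q (w * s) (w * proj₁ p , w * proj₂ p)
combination-* {Q} {w = w} 0≤w (vs , lv , nv , sv , xv , yv) =
  map (w *_) vs , trans (length-map _ vs) lv , map⁺ (All.map (0≤* 0≤w) nv) ,
  trans (sumℚ-map-* w vs) (cong (w *_) sv) ,
  trans (weightedSum-map-* proj₁ w vs Q) (cong (w *_) xv) ,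
  trans (weightedSum-map-* proj₂ w vs Q) (cong (w *_) yv)

combination-∷ : ∀ {Q s p w} q → 0ℚ ≤ w → Combination Q s p →
  Combination (q ∷ Q) (w + s) (w * proj₁ q + proj₁ p , w * proj₂ q + proj₂ p)
combination-∷ {w = w} q 0≤w (ws , lw , nw , sw , xw , yw) =
  w ∷ ws , cong suc lw , 0≤w ∷ nw , cong (w +_) sw , cong (w * proj₁ q +_) xw , cong (w * proj₂ q +_) yw

combination-of-hull-points : ∀ {Q P} ws → All (InHull Q) P → length ws ≡ length P → All (0ℚ ≤_) ws →
  Combination Q (sumℚ ws) (weightedSum proj₁ ws P , weightedSum proj₂ ws P)
combination-of-hull-points {Q} []       []           refl []           = combination-zero Q
combination-of-hull-points {Q} {q ∷ _} (w ∷ ws) (q∈Q ∷ P∈Q) eq (0≤w ∷ 0≤ws) =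
  combination-+ (subst (λ s → Combination Q s (w * proj₁ q , w * proj₂ q)) (*-identityʳ w) (combination-* 0≤w q∈Q))
                (combination-of-hull-points ws P∈Q (suc-injective eq) 0≤ws)

InHull-trans : ∀ {Q P p} → All (InHull Q) P → InHull P p → InHull Q p
InHull-trans {Q} P∈Q (ws , lw , nw , sw , xw , yw) =
  subst₂ (Combination Q) sw (cong₂ _,_ xw yw) (combination-of-hull-points ws P∈Q lw nw)

∈⇒InHull : ∀ {Q q} → q ∈ Q → InHull Q q
∈⇒InHull {q ∷ Q} (here refl) =
  subst₂ (Combination (q ∷ Q)) (+-identityʳ 1ℚ) (cong₂ _,_ (1*p+0≡p (proj₁ q)) (1*p+0≡p (proj₂ q)))
    (combination-∷ q (nonNegative⁻¹ 1ℚ) (combination-zero Q))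
  where
  1*p+0≡p : ∀ p → 1ℚ * p + 0ℚ ≡ p
  1*p+0≡p p = trans (+-identityʳ _) (*-identityˡ p)
∈⇒InHull {r ∷ Q} {q} (there q∈Q) =
  subst₂ (Combination (r ∷ Q)) (+-identityˡ 1ℚ) (cong₂ _,_ (0*p+q≡q (proj₁ r) _) (0*p+q≡q (proj₂ r) _))
    (combination-∷ r ≤-refl (∈⇒InHull q∈Q))
  where
  0*p+q≡q : ∀ p q → 0ℚ * p + q ≡ q
  0*p+q≡q p q = trans (cong (_+ q) (*-zeroˡ p)) (+-identityˡ q)

InHull-⊆ : ∀ {P Q} → P ⊆ Q → InHull P ⊆ℚ² InHull Q
InHull-⊆ P⊆Q _ = InHull-trans (All.tabulate (λ q∈P → ∈⇒InHull (P⊆Q q∈P)))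

affine : ℚ → ℚ → ℚ → Point → ℚ
affine α β γ p = α * proj₁ p + β * proj₂ p + γ

weightedSum-affine : ∀ α β γ ws ps → length ws ≡ length ps →
  weightedSum (affine α β γ) ws ps ≡ α * weightedSum proj₁ ws ps + β * weightedSum proj₂ ws ps + γ * sumℚ ws
weightedSum-affine α β γ []       []       _  = solve 3 (λ α β γ → con 0ℚ := α :* con 0ℚ :+ β :* con 0ℚ :+ γ :* con 0ℚ) refl α β γ
weightedSum-affine α β γ (w ∷ ws) (q ∷ ps) eq =
  trans (cong (w * affine α β γ q +_) (weightedSum-affine α β γ ws ps (suc-injective eq)))
        (distribute α β γ w (proj₁ q) (proj₂ q) (weightedSum proj₁ ws ps) (weightedSum proj₂ ws ps) (sumℚ ws))
  where
  distribute : ∀ α β γ w x y X Y S →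
    w * (α * x + β * y + γ) + (α * X + β * Y + γ * S) ≡ α * (w * x + X) + β * (w * y + Y) + γ * (w + S)
  distribute = solve 9 (λ α β γ w x y X Y S →
    w :* (α :* x :+ β :* y :+ γ) :+ (α :* X :+ β :* Y :+ γ :* S)
    := α :* (w :* x :+ X) :+ β :* (w :* y :+ Y) :+ γ :* (w :+ S)) refl

0≤weightedSum : ∀ f ws ps → All (λ q → 0ℚ ≤ f q) ps → All (0ℚ ≤_) ws → 0ℚ ≤ weightedSum f ws ps
0≤weightedSum f []       _        _            _            = ≤-refl
0≤weightedSum f (_ ∷ _)  []       _            _            = ≤-refl
0≤weightedSum f (w ∷ ws) (q ∷ ps) (0≤fq ∷ 0≤f) (0≤w ∷ 0≤ws) = 0≤+ (0≤* 0≤w 0≤fq) (0≤weightedSum f ws ps 0≤f 0≤ws)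

0<weightedSum : ∀ f ws ps → All (λ q → 0ℚ < f q) ps → All (0ℚ ≤_) ws → length ws ≡ length ps →
  0ℚ < sumℚ ws → 0ℚ < weightedSum f ws ps
0<weightedSum f []       []       _             _            _  0<0 = contradiction 0<0 (<-irrefl refl)
0<weightedSum f (w ∷ ws) (q ∷ ps) (0<fq ∷ 0<f) (0≤w ∷ 0≤ws) eq 0<Σ with <-cmp 0ℚ w
... | tri< 0<w _ _ =
  subst (_< w * f q + weightedSum f ws ps) (+-identityʳ 0ℚ)
    (+-mono-<-≤ (0<* (inj₁ (0<w , 0<fq))) (0≤weightedSum f ws ps (All.map <⇒≤ 0<f) 0≤ws))
... | tri≈ _ refl _ =
  subst (0ℚ <_) (sym (trans (cong (_+ weightedSum f ws ps) (*-zeroˡ (f q))) (+-identityˡ _)))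
    (0<weightedSum f ws ps 0<f 0≤ws (suc-injective eq) (subst (0ℚ <_) (+-identityˡ _) 0<Σ))
... | tri> _ _ w<0 = contradiction (≤-<-trans 0≤w w<0) (<-irrefl refl)

affine-positive-on-hull : ∀ α β γ {ps p} → All (λ q → 0ℚ < affine α β γ q) ps → InHull ps p → 0ℚ < affine α β γ p
affine-positive-on-hull α β γ {ps} {p} pos (ws , lw , nw , sw , xw , yw) =
  subst (0ℚ <_) value (0<weightedSum (affine α β γ) ws ps pos nw lw (subst (0ℚ <_) (sym sw) (positive⁻¹ 1ℚ)))
  where
  value : weightedSum (affine α β γ) ws ps ≡ affine α β γ p
  value = begin
    weightedSum (affine α β γ) ws ps                                        ≡⟨ weightedSum-affine α β γ ws ps lw ⟩
    α * weightedSum proj₁ ws ps + β * weightedSum proj₂ ws ps + γ * sumℚ ws ≡⟨ cong₂ (λ x y → α * x + β * y + γ * sumℚ ws) xw yw ⟩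
    α * proj₁ p + β * proj₂ p + γ * sumℚ ws                                 ≡⟨ cong (λ s → α * proj₁ p + β * proj₂ p + γ * s) sw ⟩
    α * proj₁ p + β * proj₂ p + γ * 1ℚ                                      ≡⟨ cong (α * proj₁ p + β * proj₂ p +_) (*-identityʳ γ) ⟩
    affine α β γ p                                                          ∎
    where open ≡-Reasoning

_∈ᵢ_ : ℚ → Interval → Set
x ∈ᵢ J = lo J ≤ x × x ≤ hi J

_∈ᵢ?_ : ∀ x J → Dec (x ∈ᵢ J)
x ∈ᵢ? J = (lo J ≤? x) ×-dec (x ≤? hi J)

parabola : ℚ → Point
parabola x = (x , x * x)

polar : ℚ → ℚ → Point
polar c d = ((c + d) * ½ , c * d)

polar-diagonal : ∀ x → polar x x ≡ parabola x
polar-diagonal x = cong (_, x * x) (solve 1 (λ x → (x :+ x) :* con ½ := x) refl x)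

∈ᵢ⇒affineCoordinate : ∀ {c} J → c ∈ᵢ J → ∃ λ s → 0ℚ ≤ s × s ≤ 1ℚ × lo J + s * (hi J - lo J) ≡ c
∈ᵢ⇒affineCoordinate {c} J (a≤c , c≤b) =
  (c - a) * r , 0≤* (p≤q⇒0≤q-p a≤c) 0≤r ,
  ≤-trans (*-monoʳ-≤-nonNeg r {{nonNegative 0≤r}} (+-monoˡ-≤ (- a) c≤b)) (≤-reflexive (*-inverseʳ h)) ,
  (begin
    a + (c - a) * r * h   ≡⟨ cong (a +_) (*-assoc (c - a) r h) ⟩
    a + (c - a) * (r * h) ≡⟨ cong (λ z → a + (c - a) * z) (*-inverseˡ h) ⟩
    a + (c - a) * 1ℚ      ≡⟨ solve 2 (λ a c → a :+ (c :- a) :* con 1ℚ := c) refl a c ⟩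
    c                     ∎)
  where
  open ≡-Reasoning
  a = lo J
  h = hi J - lo J
  instance
    h-positive : Positive h
    h-positive = positive (p<q⇒0<q-p (lo<hi J))
    h-nonZero : NonZero h
    h-nonZero = pos⇒nonZero h
  r = 1/ h
  0≤r : 0ℚ ≤ r
  0≤r = <⇒≤ (positive⁻¹ r {{1/pos⇒pos h}})

-- The weights are the quadratic Bernstein polynomials in the affine coordinates
-- s, t of the two arguments.
polar-combination : ∀ J {s t} → 0ℚ ≤ s → s ≤ 1ℚ → 0ℚ ≤ t → t ≤ 1ℚ →
  InHull (intervalPoints J) (polar (lo J + s * (hi J - lo J)) (lo J + t * (hi J - lo J)))
polar-combination J {s} {t} 0≤s s≤1 0≤t t≤1 =
  (1-s * 1-t ∷ 1-s * t + s * 1-t ∷ s * t ∷ []) , refl ,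
  (0≤* 0≤1-s 0≤1-t ∷ 0≤+ (0≤* 0≤1-s 0≤t) (0≤* 0≤s 0≤1-t) ∷ 0≤* 0≤s 0≤t ∷ []) ,
  solve 2 (λ s t → (con 1ℚ :- s) :* (con 1ℚ :- t) :+ (((con 1ℚ :- s) :* t :+ s :* (con 1ℚ :- t)) :+ (s :* t :+ con 0ℚ))
               := con 1ℚ) refl s t ,
  solve 4 (λ a b s t →
    (con 1ℚ :- s) :* (con 1ℚ :- t) :* a :+ (((con 1ℚ :- s) :* t :+ s :* (con 1ℚ :- t)) :* ((a :+ b) :* con ½) :+ (s :* t :* b :+ con 0ℚ))
    := ((a :+ s :* (b :- a)) :+ (a :+ t :* (b :- a))) :* con ½) refl (lo J) (hi J) s t ,
  solve 4 (λ a b s t →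
    (con 1ℚ :- s) :* (con 1ℚ :- t) :* (a :* a) :+ (((con 1ℚ :- s) :* t :+ s :* (con 1ℚ :- t)) :* (a :* b) :+ (s :* t :* (b :* b) :+ con 0ℚ))
    := (a :+ s :* (b :- a)) :* (a :+ t :* (b :- a))) refl (lo J) (hi J) s t
  where
  1-s = 1ℚ - s
  1-t = 1ℚ - t
  0≤1-s = p≤q⇒0≤q-p s≤1
  0≤1-t = p≤q⇒0≤q-p t≤1

polar-∈-hull : ∀ {c d} J → c ∈ᵢ J → d ∈ᵢ J → InHull (intervalPoints J) (polar c d)
polar-∈-hull J c∈J d∈J =
  let s , 0≤s , s≤1 , c≡ = ∈ᵢ⇒affineCoordinate J c∈J
      t , 0≤t , t≤1 , d≡ = ∈ᵢ⇒affineCoordinate J d∈J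
  in subst₂ (λ c d → InHull (intervalPoints J) (polar c d)) c≡ d≡ (polar-combination J 0≤s s≤1 0≤t t≤1)

parabola-∈-hull : ∀ {x} J → x ∈ᵢ J → InHull (intervalPoints J) (parabola x)
parabola-∈-hull {x} J x∈J = subst (InHull (intervalPoints J)) (polar-diagonal x) (polar-∈-hull J x∈J x∈J)

intervalPoints-∈-hull : ∀ I J → I ⊆ᵢ J → All (InHull (intervalPoints J)) (intervalPoints I)
intervalPoints-∈-hull I J (lJ≤lI , hI≤hJ) =
  parabola-∈-hull J lI∈J ∷ polar-∈-hull J lI∈J hI∈J ∷ parabola-∈-hull J hI∈J ∷ []
  where
  lI∈J = lJ≤lI , ≤-trans (<⇒≤ (lo<hi I)) hI≤hJ
  hI∈J = ≤-trans lJ≤lI (<⇒≤ (lo<hi I)) , hI≤hJ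

interval-hull⊆F : ∀ {J} B → J ∈ intervals B → InHull (intervalPoints J) ⊆ℚ² F B
interval-hull⊆F B J∈B = InHull-⊆ (λ q∈J → ∈-concatMap⁺ intervalPoints (lose J∈B q∈J))

F-mono : ∀ A B → A ≤𝓘 B → F A ⊆ℚ² F B
F-mono A B A≤B _ = InHull-trans (concat⁺ (map⁺ {f = intervalPoints} (All.map (λ {I} → generators-∈-F {I}) A≤B)))
  where
  generators-∈-F : ∀ {I} → Any (I ⊆ᵢ_) (intervals B) → All (F B) (intervalPoints I)
  generators-∈-F {I} I⊆B with find I⊆B
  ... | J , J∈B , I⊆J = All.map (λ {q} → interval-hull⊆F B J∈B q) (intervalPoints-∈-hull I J I⊆J)

tangent : ℚ → Point → ℚ
tangent x = affine (- (x + x)) 1ℚ (x * x)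

tangent-parabola : ∀ x a → tangent x (parabola a) ≡ (a - x) * (a - x)
tangent-parabola = solve 2 (λ x a → :- (x :+ x) :* a :+ con 1ℚ :* (a :* a) :+ x :* x := (a :- x) :* (a :- x)) refl

tangent-polar : ∀ x c d → tangent x (polar c d) ≡ (c - x) * (d - x)
tangent-polar = solve 3 (λ x c d →
  :- (x :+ x) :* ((c :+ d) :* con ½) :+ con 1ℚ :* (c :* d) :+ x :* x := (c :- x) :* (d :- x)) refl

tangent-touches : ∀ x → tangent x (parabola x) ≡ 0ℚ
tangent-touches = solve 1 (λ x → :- (x :+ x) :* x :+ con 1ℚ :* (x :* x) :+ x :* x := con 0ℚ) refl

tangent-positive-off-interval : ∀ {x} J → ¬ x ∈ᵢ J → All (λ q → 0ℚ < tangent x q) (intervalPoints J)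
tangent-positive-off-interval {x} J x∉J =
  subst (0ℚ <_) (sym (tangent-parabola x a)) (0<* (Sum.map < proj₁ , proj₁ > < proj₁ , proj₁ > signs)) ∷
  subst (0ℚ <_) (sym (tangent-polar x a b)) (0<* signs) ∷
  subst (0ℚ <_) (sym (tangent-parabola x b)) (0<* (Sum.map < proj₂ , proj₂ > < proj₂ , proj₂ > signs)) ∷ []
  where
  a = lo J
  b = hi J
  signs : (0ℚ < a - x × 0ℚ < b - x) ⊎ (a - x < 0ℚ × b - x < 0ℚ)
  signs with a ≤? x | x ≤? b
  ... | yes a≤x | yes x≤b = contradiction (a≤x , x≤b) x∉J
  ... | no a≰x  | _       = inj₁ (p<q⇒0<q-p x<a , p<q⇒0<q-p (<-trans x<a (lo<hi J)))
    where x<a = ≰⇒> a≰x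
  ... | yes _   | no x≰b  = inj₂ (p<q⇒p-q<0 (<-trans (lo<hi J) b<x) , p<q⇒p-q<0 b<x)
    where b<x = ≰⇒> x≰b

parabola-point-covered : ∀ {x} Ks → InHull (concatMap intervalPoints Ks) (parabola x) → Any (x ∈ᵢ_) Ks
parabola-point-covered {x} Ks x∈hull with any? (x ∈ᵢ?_) Ks
... | yes x∈Ks = x∈Ks
... | no  x∉Ks = contradiction (subst (0ℚ <_) (tangent-touches x) tangent-positive) (<-irrefl refl)
  where
  tangent-positive : 0ℚ < tangent x (parabola x)
  tangent-positive = affine-positive-on-hull (- (x + x)) 1ℚ (x * x)
    (concat⁺ (map⁺ {f = intervalPoints} (All.map (λ {K} → tangent-positive-off-interval K) (¬Any⇒All¬ Ks x∉Ks)))) x∈hull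

AllPairs-∈ : ∀ {a ℓ} {A : Set a} {R : Rel A ℓ} {xs x y} → (∀ u v → R u v → R v u) → AllPairs R xs →
  x ∈ xs → y ∈ xs → x ≡ y ⊎ R x y
AllPairs-∈ _     (_ ∷ _)   (here refl) (here refl) = inj₁ refl
AllPairs-∈ _     (Rx ∷ _)  (here refl) (there y∈)  = inj₂ (All.lookup Rx y∈)
AllPairs-∈ R-sym (Ry ∷ _)  (there x∈)  (here refl) = inj₂ (R-sym _ _ (All.lookup Ry x∈))
AllPairs-∈ R-sym (_ ∷ Rxs) (there x∈)  (there y∈)  = AllPairs-∈ R-sym Rxs x∈ y∈

Disjoint-sym : ∀ I J → Disjoint I J → Disjoint J I
Disjoint-sym _ _ = Sum.swap

right-of : ∀ {J K x} → hi J < x → x ∈ᵢ K → J ≡ K ⊎ Disjoint J K → hi J < lo K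
right-of hJ<x (_ , x≤hK) (inj₁ refl)         = contradiction (<-≤-trans hJ<x x≤hK) (<-irrefl refl)
right-of _    _          (inj₂ (inj₁ hJ<lK)) = hJ<lK
right-of {J} hJ<x (_ , x≤hK) (inj₂ (inj₂ hK<lJ)) =
  contradiction (≤-<-trans x≤hK (<-trans (<-≤-trans hK<lJ (<⇒≤ (lo<hi J))) hJ<x)) (<-irrefl refl)

leastLoAbove : ℚ → List Interval → ℚ → ℚ
leastLoAbove h []       d = d
leastLoAbove h (K ∷ Ks) d with h <? lo K
... | yes _ = lo K ⊓ leastLoAbove h Ks d
... | no  _ = leastLoAbove h Ks d

<-leastLoAbove : ∀ {h d} Ks → h < d → h < leastLoAbove h Ks d
<-leastLoAbove []           h<d = h<d
<-leastLoAbove {h} (K ∷ Ks) h<d with h <? lo K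
... | yes h<lK = <-⊓ h<lK (<-leastLoAbove Ks h<d)
... | no  _    = <-leastLoAbove Ks h<d

leastLoAbove≤ : ∀ {h} Ks d → leastLoAbove h Ks d ≤ d
leastLoAbove≤     []       d = ≤-refl
leastLoAbove≤ {h} (K ∷ Ks) d with h <? lo K
... | yes _ = ≤-trans (p⊓q≤q (lo K) _) (leastLoAbove≤ Ks d)
... | no  _ = leastLoAbove≤ Ks d

leastLoAbove≤lo : ∀ {h d K} Ks → K ∈ Ks → h < lo K → leastLoAbove h Ks d ≤ lo K
leastLoAbove≤lo {h} (K ∷ Ks) (here refl) h<lK with h <? lo K
... | yes _    = p⊓q≤p (lo K) _
... | no  h≮lK = contradiction h<lK h≮lK
leastLoAbove≤lo {h} (K′ ∷ Ks) (there K∈Ks) h<lK with h <? lo K′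
... | yes _ = ≤-trans (p⊓q≤q (lo K′) _) (leastLoAbove≤lo Ks K∈Ks h<lK)
... | no  _ = leastLoAbove≤lo Ks K∈Ks h<lK

-- x is taken strictly between hi J and the nearest left endpoint beyond it.
uncovered-right-of : ∀ {Ks J} → AllPairs Disjoint Ks → J ∈ Ks → ∀ {d} → hi J < d →
  ∃ λ x → hi J < x × x ≤ d × ¬ Any (x ∈ᵢ_) Ks
uncovered-right-of {Ks} disjoint J∈Ks {d} hJ<d =
  let x , hJ<x , x<m = <-dense (<-leastLoAbove Ks hJ<d) in
  x , hJ<x , ≤-trans (<⇒≤ x<m) (leastLoAbove≤ Ks d) , λ x∈Ks →
    let K , K∈Ks , x∈K = find x∈Ks
        hJ<lK = right-of hJ<x x∈K (AllPairs-∈ Disjoint-sym disjoint J∈Ks K∈Ks)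
    in contradiction (<-≤-trans x<m (≤-trans (leastLoAbove≤lo Ks K∈Ks hJ<lK) (proj₁ x∈K))) (<-irrefl refl)

covering-interval : ∀ {Ks} → AllPairs Disjoint Ks → ∀ I → (∀ x → x ∈ᵢ I → Any (x ∈ᵢ_) Ks) → Any (I ⊆ᵢ_) Ks
covering-interval disjoint I covers with find (covers (lo I) (≤-refl , <⇒≤ (lo<hi I)))
... | J , J∈Ks , lJ≤lI , lI≤hJ with hi I ≤? hi J
...   | yes hI≤hJ = lose J∈Ks (lJ≤lI , hI≤hJ)
...   | no  hI≰hJ =
  let x , hJ<x , x≤hI , x∉Ks = uncovered-right-of disjoint J∈Ks (≰⇒> hI≰hJ)
  in contradiction (covers x (≤-trans lI≤hJ (<⇒≤ hJ<x) , x≤hI)) x∉Ks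

F-reflects : ∀ A B → F A ⊆ℚ² F B → A ≤𝓘 B
F-reflects A B FA⊆FB = All.tabulate λ {I} I∈A → covering-interval (pairwiseDisjoint B) I λ x x∈I →
  parabola-point-covered (intervals B)
    (FA⊆FB (parabola x) (interval-hull⊆F A I∈A (parabola x) (parabola-∈-hull I x∈I)))

mainTheorem6 : (A B : 𝓘) → ((A ≤𝓘 B → F A ⊆ℚ² F B) × (F A ⊆ℚ² F B → A ≤𝓘 B))
mainTheorem6 A B = F-mono A B , F-reflects A B
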